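{- Let $h\geqslant 1$ and let $t_0,t_1,\ldots,t_{h-1}$ be integers with $t_i\geqslant 2$ for all $0\leqslant i\leqslant h-1$ and $t_{h-1}\leqslant t_{h-2}\leqslant\cdots\leqslant t_1\leqslant t_0$. Then the complete level-wise regular trees $T^1_{t_0,\ldots,t_{h-1}}$ and $T^2_{t_0,\ldots,t_{h-1}}$ are strongly antimagic.
   Context: $T^1_{t_0,\ldots,t_{h-1}}$ is the tree with a root $w$ in which the vertices at distance $i$ from $w$ form level $i$ ($0\leqslant i\leqslant h$), every vertex at level $i$ with $0\leqslant i\leqslant h-1$ has degree $t_i$, and the vertices at level $h$ are leaves (degree $t_h=1$). $T^2_{t_0,\ldots,t_{h-1}}$ is defined in the same way, except that level $0$ consists of two adjacent roots $w,w'$ and level $i$ consists of the vertices at distance $i$ from $\{w,w'\}$. For a graph with $m$ edges, a strongly antimagic labeling is a bijection $f:E\to\{1,\ldots,m\}$ such that the vertex sums $\phi_f(x)=\sum_{e\ni x}f(e)$ are pairwise distinct and $\phi_f(x)>\phi_f(y)$ whenever $\deg(x)>\deg(y)$; a graph is strongly antimagic if it admits one. -}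

module Defs where

open import Data.Nat using (ℕ; zero; suc; _+_; _∸_; _≤_; _<_)
open import Data.Nat.Properties using (_≟_)
open import Data.Fin using (Fin; toℕ)
open import Data.List using (List; []; _∷_; [_]; map; concatMap; upTo; length; lookup; _++_; allFin)
open import Data.Nat.ListAction using (sum)
open import Data.List.Properties using (≡-dec)
open import Data.List.Membership.Propositional using (_∈_)
open import Data.Product using (_×_; _,_; ∃)
open import Data.Bool using (Bool; true; false; if_then_else_; _∨_)
open import Relation.Nullary using (¬_)
open import Relation.Nullary.Decidable using (⌊_⌋)
open import Relation.Binary.PropositionalEquality using (_≡_)
open import Function.Definitions using (Bijective)

-- Vertices are addresses (lists of naturals), root first.
Vertex : Set
Vertex = List ℕ

_≟V_ : (x y : Vertex) → Relation.Nullary.Dec (x ≡ y)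
_≟V_ = ≡-dec _≟_

record Graph : Set where
  field
    vertices : List Vertex
    edges    : List (Vertex × Vertex)

open Graph public

numEdges : Graph → ℕ
numEdges G = length (edges G)

edgeAt : (G : Graph) → Fin (numEdges G) → Vertex × Vertex
edgeAt G = lookup (edges G)

incident : Vertex → Vertex × Vertex → Bool
incident x (u , v) = ⌊ x ≟V u ⌋ ∨ ⌊ x ≟V v ⌋

degree : Graph → Vertex → ℕ
degree G x = sum (map (λ e → if incident x (edgeAt G e) then 1 else 0) (allFin (numEdges G)))

-- vertex sum under labeling f : edges → {1..m} (label of edge e is toℕ (f e) + 1)
vertexSum : (G : Graph) → (Fin (numEdges G) → Fin (numEdges G)) → Vertex → ℕ
vertexSum G f x =
  sum (map (λ e → if incident x (edgeAt G e) then suc (toℕ (f e)) else 0) (allFin (numEdges G)))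

IsStronglyAntimagicLabeling : (G : Graph) → (Fin (numEdges G) → Fin (numEdges G)) → Set
IsStronglyAntimagicLabeling G f =
  Bijective _≡_ _≡_ f
  × (∀ x y → x ∈ vertices G → y ∈ vertices G → ¬ x ≡ y → ¬ vertexSum G f x ≡ vertexSum G f y)
  × (∀ x y → x ∈ vertices G → y ∈ vertices G → degree G y < degree G x → vertexSum G f y < vertexSum G f x)

StronglyAntimagic : Graph → Set
StronglyAntimagic G = ∃ λ f → IsStronglyAntimagicLabeling G f

-- Rooted tree with branching numbers bs = b₀ ∷ b₁ ∷ …: the root [] has b₀ children
-- [c] (c < b₀), each vertex at level i has bᵢ children (path extended by c < bᵢ).
treeVertices : List ℕ → List Vertex
treeVertices [] = [ [] ]
treeVertices (b ∷ bs) = [] ∷ concatMap (λ c → map (c ∷_) (treeVertices bs)) (upTo b)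

treeEdges : List ℕ → List (Vertex × Vertex)
treeEdges [] = []
treeEdges (b ∷ bs) =
  concatMap (λ c → (c ∷ [] , []) ∷ map (λ { (u , v) → (c ∷ u , c ∷ v) }) (treeEdges bs)) (upTo b)

pred₁ : List ℕ → List ℕ
pred₁ = map (λ t → t ∸ 1)

-- T¹_{t₀,…,t_{h-1}}: root has t₀ children, level-i vertex (1 ≤ i ≤ h-1) has t_i − 1
-- children (degree t_i), level-h vertices are leaves.
T1 : List ℕ → Graph
T1 [] = record { vertices = treeVertices [] ; edges = treeEdges [] }
T1 (t ∷ ts) = record { vertices = treeVertices (t ∷ pred₁ ts) ; edges = treeEdges (t ∷ pred₁ ts) }

-- T²_{t₀,…,t_{h-1}}: two adjacent roots w = [0], w' = [1], each with t₀ − 1 children,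
-- level-i vertices having t_i − 1 children.
T2 : List ℕ → Graph
T2 ts = record
  { vertices = map (0 ∷_) (treeVertices (pred₁ ts)) ++ map (1 ∷_) (treeVertices (pred₁ ts))
  ; edges = (0 ∷ [] , 1 ∷ [])
            ∷ map (λ { (u , v) → (0 ∷ u , 0 ∷ v) }) (treeEdges (pred₁ ts))
            ++ map (λ { (u , v) → (1 ∷ u , 1 ∷ v) }) (treeEdges (pred₁ ts))
  }

-- Order the vertices deeper first, and lexicographically within a level. Every edge joins a
-- vertex, its key, to that vertex's parent (the edge between the two roots of T² is keyed by one
-- of them), and is labelled 1 + the rank of its key. The sum at a vertex x is then the label of
-- its parent edge plus those of its child edges. If y precedes x, the parent edge of y precedes
-- that of x, and as the degrees do not increase with depth, y has at most as many children as x,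
-- each preceding each child of x. Hence vertex sums increase strictly along the order while
-- degrees weakly decrease, which gives distinct sums and the degree condition at once. The roots
-- need t₀ ≥ 2: for a non-root vertex of T¹, the root edge to its level-1 ancestor outweighs its
-- parent edge and the other t₀ - 1 ≥ 1 root edges outweigh its child edges; the two roots of T²
-- share their parent edge and are separated by their t₀ - 1 ≥ 1 children.
module Submission where

open import Defs
open import Data.Nat using (ℕ; zero; suc; _+_; _∸_; _≤_; _<_; _≥_; z≤n; s≤s)
open import Data.Nat.Properties
open import Data.Nat.ListAction using (sum)
open import Data.Nat.ListAction.Properties using (sum-↭)
open import Data.List
  using (List; []; _∷_; [_]; _++_; _∷ʳ_; map; concatMap; upTo; length; lookup; allFin; tabulate
        ; filter; filterᵇ; cartesianProductWith)
open import Data.List.Properties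
  using (concatMap-cong; concatMap-map; concatMap-pure; map-concatMap; map-tabulate; tabulate-lookup
        ; map-++; map-∘; map-cong; length-map; length-applyUpTo; length-++; ++-identityʳ
        ; ∷-injective; ∷-injectiveˡ; ∷-injectiveʳ; filter-++; filter-notAll)
open import Data.List.Membership.Propositional using (_∈_)
open import Data.List.Membership.Propositional.Properties
  using (∈-lookup; ∈-map⁺; ∈-map⁻; ∈-++⁻; ∈-upTo⁺; ∈-upTo⁻; ∈-filter⁻; ∈-∃++; ∈-cartesianProductWith⁻)
open import Data.List.Relation.Unary.Any as Any using (here; there)
open import Data.List.Relation.Unary.All as All using (All; []; _∷_)
open import Data.List.Relation.Unary.Unique.Propositional using (Unique; []; _∷_)
import Data.List.Relation.Unary.Unique.Propositional.Properties as Unique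
open import Data.List.Relation.Unary.Linked as Linked using (Linked; []; [-]; _∷_)
open import Data.List.Relation.Unary.Linked.Properties using (map⁺)
open import Data.List.Relation.Binary.Permutation.Propositional using (_↭_; ↭-sym)
open import Data.List.Relation.Binary.Permutation.Propositional.Properties using (shift; ↭-length; ∈-resp-↭)
import Data.List.Relation.Binary.Permutation.Propositional.Properties as ↭
open import Data.List.Relation.Binary.Lex.Strict using (Lex-<; <-transitive; <-irreflexive; <-compare; <-decidable)
open import Data.List.Relation.Binary.Lex.Core using (halt; this; next)
open import Data.List.Relation.Binary.Pointwise using (Pointwise-≡⇒≡; ≡⇒Pointwise-≡)
open import Data.Fin using (Fin; toℕ; fromℕ<; punchOut)
import Data.Fin as Fin
open import Data.Fin.Properties using (toℕ-fromℕ<; any?; punchOut-injective; injective⇒≤)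
open import Data.Product using (_×_; _,_; ∃; ∃₂; proj₁; proj₂)
open import Data.Sum using (_⊎_; inj₁; inj₂)
open import Data.Bool using (T?; Bool; true; false; if_then_else_; _∨_)
open import Data.Empty using (⊥-elim)
open import Function using (_∘_; id)
open import Function.Bundles using (mk⇔)
open import Function.Definitions using (Bijective; Injective; Surjective)
open import Level using (0ℓ)
open import Relation.Binary using (Rel; tri<; tri≈; tri>)
open import Relation.Binary.PropositionalEquality
  using (_≡_; _≢_; refl; sym; trans; cong; cong₂; subst; subst₂; isEquivalence; module ≡-Reasoning)
open import Relation.Nullary using (¬_; Dec; yes; no)
open import Relation.Nullary.Decidable using (⌊_⌋; isYes≗does; dec-true; dec-false; does-⇔)

injective⇒surjective : ∀ {n} (f : Fin n → Fin n) → Injective _≡_ _≡_ f → Surjective _≡_ _≡_ f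
injective⇒surjective {zero} f inj ()
injective⇒surjective {suc n} f inj i with any? (λ j → f j Fin.≟ i)
... | yes (j , fj≡i) = j , λ { refl → fj≡i }
... | no ∄j = ⊥-elim (<-irrefl refl (injective⇒≤ g-injective))
  where
  -- if i is missed, punching it out gives an injection Fin (suc n) → Fin n
  i≢f : ∀ j → i ≢ f j
  i≢f j eq = ∄j (j , sym eq)
  g : Fin (suc n) → Fin n
  g j = punchOut (i≢f j)
  g-injective : Injective _≡_ _≡_ g
  g-injective eq = inj (punchOut-injective (i≢f _) (i≢f _) eq)

module _ {_⊏_ : Rel Vertex 0ℓ} (connex : ∀ {x y} → x ≢ y → x ⊏ y ⊎ y ⊏ x) where

  isStronglyAntimagic-byOrder : (G : Graph) (f : Fin (numEdges G) → Fin (numEdges G)) →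
    Bijective _≡_ _≡_ f →
    (∀ {x y} → x ∈ vertices G → y ∈ vertices G → y ⊏ x → vertexSum G f y < vertexSum G f x) →
    (∀ {x y} → x ∈ vertices G → y ∈ vertices G → x ⊏ y → degree G x ≤ degree G y) →
    IsStronglyAntimagicLabeling G f
  isStronglyAntimagic-byOrder G f bij sum-mono deg-anti = bij , distinct , degree-mono
    where
    distinct : ∀ x y → x ∈ vertices G → y ∈ vertices G → x ≢ y → vertexSum G f x ≢ vertexSum G f y
    distinct x y x∈ y∈ x≢y eq with connex x≢y
    ... | inj₁ x⊏y = <-irrefl eq (sum-mono y∈ x∈ x⊏y)
    ... | inj₂ y⊏x = <-irrefl (sym eq) (sum-mono x∈ y∈ y⊏x)
    degree-mono : ∀ x y → x ∈ vertices G → y ∈ vertices G →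
      degree G y < degree G x → vertexSum G f y < vertexSum G f x
    degree-mono x y x∈ y∈ dy<dx with x ≟V y
    ... | yes refl = ⊥-elim (<-irrefl refl dy<dx)
    ... | no x≢y with connex x≢y
    ...   | inj₁ x⊏y = ⊥-elim (<⇒≱ dy<dx (deg-anti x∈ y∈ x⊏y))
    ...   | inj₂ y⊏x = sum-mono x∈ y∈ y⊏x

_<lex_ : Rel Vertex 0ℓ
_<lex_ = Lex-< _≡_ _<_

data _≺_ (k k' : Vertex) : Set where
  deeper : length k' < length k → k ≺ k'
  level  : length k ≡ length k' → k <lex k' → k ≺ k'

<lex-trans : ∀ {x y z} → x <lex y → y <lex z → x <lex z
<lex-trans = <-transitive isEquivalence <-resp₂-≡ <-trans

<lex-irrefl : ∀ {x} → ¬ (x <lex x)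
<lex-irrefl = <-irreflexive <-irrefl (≡⇒Pointwise-≡ refl)

≺-irrefl : ∀ {k} → ¬ (k ≺ k)
≺-irrefl (deeper p) = <-irrefl refl p
≺-irrefl (level _ p) = <lex-irrefl p

≺-trans : ∀ {a b c} → a ≺ b → b ≺ c → a ≺ c
≺-trans (deeper p) (deeper q) = deeper (<-trans q p)
≺-trans {a} (deeper p) (level e _) = deeper (subst (_< length a) e p)
≺-trans {c = c} (level e _) (deeper q) = deeper (subst (length c <_) (sym e) q)
≺-trans (level e p) (level e' q) = level (trans e e') (<lex-trans p q)

≺-connex : ∀ {x y} → x ≢ y → x ≺ y ⊎ y ≺ x
≺-connex {x} {y} x≢y with <-cmp (length x) (length y)
... | tri< p _ _ = inj₂ (deeper p)
... | tri> _ _ p = inj₁ (deeper p)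
... | tri≈ _ e _ with <-compare sym <-cmp x y
...   | tri< p _ _ = inj₁ (level e p)
...   | tri≈ _ p _ = ⊥-elim (x≢y (Pointwise-≡⇒≡ p))
...   | tri> _ _ p = inj₂ (level (sym e) p)

_≺?_ : ∀ k k' → Dec (k ≺ k')
k ≺? k' with length k' <? length k
... | yes p = yes (deeper p)
... | no ¬p with length k ≟ length k' | <-decidable _≟_ _<?_ k k'
...   | yes e | yes p = yes (level e p)
...   | yes _ | no ¬q = no λ { (deeper p) → ¬p p ; (level _ q) → ¬q q }
...   | no ¬e | _     = no λ { (deeper p) → ¬p p ; (level e _) → ¬e e }

≺-length : ∀ {y x} → y ≺ x → length x ≤ length y
≺-length (deeper p) = <⇒≤ p
≺-length (level e _) = ≤-reflexive (sym e)

[]-minimal : ∀ {x} → ¬ ([] ≺ x)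
[]-minimal (deeper ())
[]-minimal {[]} (level _ p) = <lex-irrefl p
[]-minimal {_ ∷ _} (level () _)

∷ʳ-≺ : ∀ {y x} → y ≺ x → ∀ c c' → (y ∷ʳ c) ≺ (x ∷ʳ c')
∷ʳ-≺ {y} {x} (deeper p) c c' = deeper (subst₂ _<_ (sym (length-++ x)) (sym (length-++ y)) (+-monoˡ-< 1 p))
∷ʳ-≺ {y} {x} (level e p) c c' = level (trans (length-++ y) (trans (cong (_+ 1) e) (sym (length-++ x)))) (lex-∷ʳ e p)
  where
  lex-∷ʳ : ∀ {y x} → length y ≡ length x → y <lex x → (y ∷ʳ c) <lex (x ∷ʳ c')
  lex-∷ʳ () halt
  lex-∷ʳ _ (this p) = this p
  lex-∷ʳ e (next refl p) = next refl (lex-∷ʳ (suc-injective e) p)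

rank : List Vertex → Vertex → ℕ
rank ks k = length (filter (_≺? k) ks)

weight : List Vertex → Vertex → ℕ
weight ks k = suc (rank ks k)

rank-mono : ∀ ks {k k'} → k ≺ k' → rank ks k ≤ rank ks k'
rank-mono [] _ = z≤n
rank-mono (u ∷ ks) {k} {k'} k≺k' with u ≺? k | u ≺? k'
... | yes _   | yes _    = s≤s (rank-mono ks k≺k')
... | yes u≺k | no u⊀k'  = ⊥-elim (u⊀k' (≺-trans u≺k k≺k'))
... | no _    | yes _    = m≤n⇒m≤1+n (rank-mono ks k≺k')
... | no _    | no _     = rank-mono ks k≺k'

rank-strict : ∀ ks {k k'} → k ∈ ks → k ≺ k' → rank ks k < rank ks k'
rank-strict (u ∷ ks) {k} {k'} (here refl) k≺k' with u ≺? k | u ≺? k'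
... | yes u≺u | _       = ⊥-elim (≺-irrefl u≺u)
... | no _    | yes _   = s≤s (rank-mono ks k≺k')
... | no _    | no u⊀k' = ⊥-elim (u⊀k' k≺k')
rank-strict (u ∷ ks) {k} {k'} (there k∈) k≺k' with u ≺? k | u ≺? k'
... | yes _   | yes _   = s≤s (rank-strict ks k∈ k≺k')
... | yes u≺k | no u⊀k' = ⊥-elim (u⊀k' (≺-trans u≺k k≺k'))
... | no _    | yes _   = m≤n⇒m≤1+n (rank-strict ks k∈ k≺k')
... | no _    | no _    = rank-strict ks k∈ k≺k'

rank<length : ∀ ks {k} → k ∈ ks → rank ks k < length ks
rank<length ks k∈ = filter-notAll (_≺? _) ks (Any.map (λ { refl → ≺-irrefl }) k∈)

rank-injective : ∀ ks {k k'} → k ∈ ks → k' ∈ ks → rank ks k ≡ rank ks k' → k ≡ k'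
rank-injective ks {k} {k'} k∈ k'∈ eq with k ≟V k'
... | yes k≡k' = k≡k'
... | no k≢k' with ≺-connex k≢k'
...   | inj₁ k≺k' = ⊥-elim (<-irrefl eq (rank-strict ks k∈ k≺k'))
...   | inj₂ k'≺k = ⊥-elim (<-irrefl (sym eq) (rank-strict ks k'∈ k'≺k))

weight-mono : ∀ ks {k k'} → k ≺ k' → weight ks k ≤ weight ks k'
weight-mono ks k≺k' = s≤s (rank-mono ks k≺k')

weight-strict : ∀ ks {k k'} → k ∈ ks → k ≺ k' → weight ks k < weight ks k'
weight-strict ks k∈ k≺k' = s≤s (rank-strict ks k∈ k≺k')

Edge : Set
Edge = Vertex × Vertex

-- tree edges are stored as (child , parent); the key of an edge is its first component
edgeKeys : List Edge → List Vertex
edgeKeys = map proj₁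

incidentKeys : List Edge → Vertex → List Vertex
incidentKeys es x = edgeKeys (filterᵇ (incident x) es)

keySum : List Edge → Vertex → ℕ
keySum es x = sum (map (weight (edgeKeys es)) (incidentKeys es x))

key∈edgeKeys : ∀ es i → proj₁ (lookup es i) ∈ edgeKeys es
key∈edgeKeys es i = ∈-map⁺ proj₁ (∈-lookup i)

incidentKeys⊆edgeKeys : ∀ es {x k} → k ∈ incidentKeys es x → k ∈ edgeKeys es
incidentKeys⊆edgeKeys es k∈ with e , e∈ , refl ← ∈-map⁻ proj₁ k∈ = ∈-map⁺ proj₁ (proj₁ (∈-filter⁻ _ e∈))

rankLabeling : (G : Graph) → Fin (numEdges G) → Fin (numEdges G)
rankLabeling G i = fromℕ< (subst (rank ks (proj₁ (edgeAt G i)) <_) (length-map proj₁ (edges G))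
  (rank<length ks (key∈edgeKeys (edges G) i)))
  where ks = edgeKeys (edges G)

toℕ-rankLabeling : ∀ G i → toℕ (rankLabeling G i) ≡ rank (edgeKeys (edges G)) (proj₁ (edgeAt G i))
toℕ-rankLabeling G i = toℕ-fromℕ< _

Unique-map⇒lookup-injective : ∀ {A B : Set} (f : A → B) {xs} → Unique (map f xs) →
  ∀ {i j} → f (lookup xs i) ≡ f (lookup xs j) → i ≡ j
Unique-map⇒lookup-injective f {_ ∷ _} (_ ∷ _) {Fin.zero} {Fin.zero} _ = refl
Unique-map⇒lookup-injective f {_ ∷ _} (fx∉ ∷ _) {Fin.zero} {Fin.suc j} eq =
  ⊥-elim (All.lookup fx∉ (∈-map⁺ f (∈-lookup j)) eq)
Unique-map⇒lookup-injective f {_ ∷ _} (fx∉ ∷ _) {Fin.suc i} {Fin.zero} eq =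
  ⊥-elim (All.lookup fx∉ (∈-map⁺ f (∈-lookup i)) (sym eq))
Unique-map⇒lookup-injective f {_ ∷ _} (_ ∷ u) {Fin.suc i} {Fin.suc j} eq =
  cong Fin.suc (Unique-map⇒lookup-injective f u eq)

rankLabeling-bijective : ∀ G → Unique (edgeKeys (edges G)) → Bijective _≡_ _≡_ (rankLabeling G)
rankLabeling-bijective G unique = injective , injective⇒surjective (rankLabeling G) injective
  where
  es = edges G
  injective : Injective _≡_ _≡_ (rankLabeling G)
  injective {i} {j} eq = Unique-map⇒lookup-injective proj₁ unique
    (rank-injective (edgeKeys es) (key∈edgeKeys es i) (key∈edgeKeys es j)
      (trans (sym (toℕ-rankLabeling G i)) (trans (cong toℕ eq) (toℕ-rankLabeling G j))))

map-allFin-lookup : ∀ {A B : Set} (xs : List A) (g : A → B) → map (g ∘ lookup xs) (allFin (length xs)) ≡ map g xs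
map-allFin-lookup xs g = begin
  map (g ∘ lookup xs) (allFin (length xs)) ≡⟨ map-tabulate id (g ∘ lookup xs) ⟩
  tabulate (g ∘ lookup xs)                 ≡⟨ map-tabulate (lookup xs) g ⟨
  map g (tabulate (lookup xs))             ≡⟨ cong (map g) (tabulate-lookup xs) ⟩
  map g xs                                 ∎
  where open ≡-Reasoning

sum-if-filterᵇ : ∀ {A : Set} (p : A → Bool) (g : A → ℕ) xs →
  sum (map (λ a → if p a then g a else 0) xs) ≡ sum (map g (filterᵇ p xs))
sum-if-filterᵇ p g [] = refl
sum-if-filterᵇ p g (x ∷ xs) with p x
... | true  = cong (g x +_) (sum-if-filterᵇ p g xs)
... | false = sum-if-filterᵇ p g xs

sum-map-const-1 : ∀ {A : Set} (xs : List A) → sum (map (λ _ → 1) xs) ≡ length xs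
sum-map-const-1 [] = refl
sum-map-const-1 (x ∷ xs) = cong suc (sum-map-const-1 xs)

vertexSum-rankLabeling : ∀ G x → vertexSum G (rankLabeling G) x ≡ keySum (edges G) x
vertexSum-rankLabeling G x = begin
  vertexSum G (rankLabeling G) x
    ≡⟨ cong sum (map-cong (λ i → cong (λ n → if incident x (edgeAt G i) then suc n else 0)
                                      (toℕ-rankLabeling G i)) (allFin _)) ⟩
  sum (map (labelIfIncident ∘ lookup es) (allFin (length es)))
    ≡⟨ cong sum (map-allFin-lookup es labelIfIncident) ⟩
  sum (map labelIfIncident es)
    ≡⟨ sum-if-filterᵇ (incident x) (w ∘ proj₁) es ⟩
  sum (map (w ∘ proj₁) (filterᵇ (incident x) es))
    ≡⟨ cong sum (map-∘ (filterᵇ (incident x) es)) ⟩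
  keySum es x ∎
  where
  open ≡-Reasoning
  es = edges G
  w = weight (edgeKeys es)
  labelIfIncident : Edge → ℕ
  labelIfIncident e = if incident x e then w (proj₁ e) else 0

degree≡length-incidentKeys : ∀ G x → degree G x ≡ length (incidentKeys (edges G) x)
degree≡length-incidentKeys G x = begin
  degree G x
    ≡⟨ cong sum (map-allFin-lookup (edges G) (λ e → if incident x e then 1 else 0)) ⟩
  sum (map (λ e → if incident x e then 1 else 0) (edges G))
    ≡⟨ sum-if-filterᵇ (incident x) (λ _ → 1) (edges G) ⟩
  sum (map (λ _ → 1) (filterᵇ (incident x) (edges G)))
    ≡⟨ sum-map-const-1 (filterᵇ (incident x) (edges G)) ⟩
  length (filterᵇ (incident x) (edges G))
    ≡⟨ length-map proj₁ (filterᵇ (incident x) (edges G)) ⟨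
  length (incidentKeys (edges G) x) ∎
  where open ≡-Reasoning

stronglyAntimagic-byRank : ∀ G → Unique (edgeKeys (edges G)) →
  (∀ {x y} → x ∈ vertices G → y ∈ vertices G → y ≺ x → keySum (edges G) y < keySum (edges G) x) →
  (∀ {x y} → x ∈ vertices G → y ∈ vertices G → x ≺ y →
    length (incidentKeys (edges G) x) ≤ length (incidentKeys (edges G) y)) →
  StronglyAntimagic G
stronglyAntimagic-byRank G unique sum-mono deg-anti =
  rankLabeling G ,
  isStronglyAntimagic-byOrder ≺-connex G (rankLabeling G) (rankLabeling-bijective G unique)
    (λ {x} {y} x∈ y∈ y≺x → subst₂ _<_ (sym (vertexSum-rankLabeling G y)) (sym (vertexSum-rankLabeling G x))
                             (sum-mono x∈ y∈ y≺x))
    (λ {x} {y} x∈ y∈ x≺y → subst₂ _≤_ (sym (degree≡length-incidentKeys G x)) (sym (degree≡length-incidentKeys G y))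
                             (deg-anti x∈ y∈ x≺y))

module _ {A : Set} (w : A → ℕ) where

  sum-map-↭ : ∀ {xs ys} → xs ↭ ys → sum (map w xs) ≡ sum (map w ys)
  sum-map-↭ p = sum-↭ (↭.map⁺ w p)

  sum-map-dominated-≤ : ∀ ys xs → length ys ≤ length xs →
    (∀ {a b} → a ∈ ys → b ∈ xs → w a ≤ w b) → sum (map w ys) ≤ sum (map w xs)
  sum-map-dominated-≤ [] xs _ _ = z≤n
  sum-map-dominated-≤ (a ∷ ys) (b ∷ xs) (s≤s len≤) w≤ =
    +-mono-≤ (w≤ (here refl) (here refl)) (sum-map-dominated-≤ ys xs len≤ (λ a∈ b∈ → w≤ (there a∈) (there b∈)))

  sum-map-dominated-< : (∀ a → 0 < w a) → ∀ ys xs → length ys ≤ length xs → 0 < length xs →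
    (∀ {a b} → a ∈ ys → b ∈ xs → w a < w b) → sum (map w ys) < sum (map w xs)
  sum-map-dominated-< w>0 [] (b ∷ xs) _ _ _ = ≤-trans (w>0 b) (m≤m+n (w b) _)
  sum-map-dominated-< _ (a ∷ ys) (b ∷ xs) (s≤s len≤) _ w< =
    +-mono-<-≤ (w< (here refl) (here refl)) (sum-map-dominated-≤ ys xs len≤ (λ a∈ b∈ → <⇒≤ (w< (there a∈) (there b∈))))

∈⇒↭-∷ : ∀ {A : Set} {x : A} {xs} → x ∈ xs → ∃ λ rest → xs ↭ x ∷ rest
∈⇒↭-∷ {x = x} x∈ with ys , zs , refl ← ∈-∃++ x∈ = ys ++ zs , shift x ys zs

branching : List ℕ → ℕ → ℕ
branching [] _ = 0
branching (b ∷ bs) zero = b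
branching (b ∷ bs) (suc i) = branching bs i

branching-antitone : ∀ {bs} → Linked _≥_ bs → ∀ {i j} → i ≤ j → branching bs j ≤ branching bs i
branching-antitone [] _ = z≤n
branching-antitone _ {zero} {zero} _ = ≤-refl
branching-antitone (b≥c ∷ lk) {zero} {suc j} _ = ≤-trans (branching-antitone lk {0} {j} z≤n) b≥c
branching-antitone [-] {j = suc _} _ = z≤n
branching-antitone (_ ∷ lk) {suc i} {suc j} (s≤s i≤j) = branching-antitone lk i≤j

branching-pred₁ : ∀ bs i → branching (pred₁ bs) i ≡ branching bs i ∸ 1
branching-pred₁ [] i = refl
branching-pred₁ (b ∷ bs) zero = refl
branching-pred₁ (b ∷ bs) (suc i) = branching-pred₁ bs i

pred₁-linked : ∀ {bs} → Linked _≥_ bs → Linked _≥_ (pred₁ bs)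
pred₁-linked lk = map⁺ (Linked.map (∸-monoˡ-≤ 1) lk)

∷-pred₁-linked : ∀ {t ts} → Linked _≥_ (t ∷ ts) → Linked _≥_ (t ∷ pred₁ ts)
∷-pred₁-linked [-] = [-]
∷-pred₁-linked (t≥u ∷ lk) = ≤-trans (m∸n≤m _ 1) t≥u ∷ pred₁-linked lk

childrenOf : ℕ → Vertex → List Vertex
childrenOf n x = map (x ∷ʳ_) (upTo n)

length-childrenOf : ∀ n x → length (childrenOf n x) ≡ n
length-childrenOf n x = trans (length-map (x ∷ʳ_) (upTo n)) (length-applyUpTo id n)

childrenOf-≺ : ∀ {y x m n a b} → y ≺ x → a ∈ childrenOf m y → b ∈ childrenOf n x → a ≺ b
childrenOf-≺ {y} {x} y≺x a∈ b∈ with c , _ , refl ← ∈-map⁻ (y ∷ʳ_) a∈ | c' , _ , refl ← ∈-map⁻ (x ∷ʳ_) b∈ =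
  ∷ʳ-≺ y≺x c c'

childrenOf-deeper : ∀ {x n a} → a ∈ childrenOf n x → length x < length a
childrenOf-deeper {x} a∈ with c , _ , refl ← ∈-map⁻ (x ∷ʳ_) a∈ = ≤-reflexive (sym (trans (length-++ x) (+-comm (length x) 1)))

map-∷-childrenOf : ∀ d y n → map (d ∷_) (childrenOf n y) ≡ childrenOf n (d ∷ y)
map-∷-childrenOf d y n = sym (map-∘ (upTo n))

prefix : ℕ → Edge → Edge
prefix c e = (c ∷ proj₁ e , c ∷ proj₂ e)

treeBlock : List ℕ → ℕ → List Edge
treeBlock bs c = ([ c ] , []) ∷ map (prefix c) (treeEdges bs)

⌊≟V⌋-true : ∀ x → ⌊ x ≟V x ⌋ ≡ true
⌊≟V⌋-true x = trans (isYes≗does (x ≟V x)) (dec-true (x ≟V x) refl)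

⌊≟V⌋-false : ∀ {x u} → x ≢ u → ⌊ x ≟V u ⌋ ≡ false
⌊≟V⌋-false {x} {u} x≢u = trans (isYes≗does (x ≟V u)) (dec-false (x ≟V u) x≢u)

incident-prefix : ∀ c y e → incident (c ∷ y) (prefix c e) ≡ incident y e
incident-prefix c y (u , v) = cong₂ _∨_ (sameHead u) (sameHead v)
  where
  sameHead : ∀ u → ⌊ (c ∷ y) ≟V (c ∷ u) ⌋ ≡ ⌊ y ≟V u ⌋
  sameHead u = trans (isYes≗does _)
    (trans (does-⇔ (mk⇔ ∷-injectiveʳ (cong (c ∷_))) ((c ∷ y) ≟V (c ∷ u)) (y ≟V u)) (sym (isYes≗does _)))

incident-child : ∀ x v → incident x (x , v) ≡ true
incident-child x v = cong (_∨ ⌊ x ≟V v ⌋) (⌊≟V⌋-true x)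

incident-false : ∀ {x u v} → x ≢ u → x ≢ v → incident x (u , v) ≡ false
incident-false x≢u x≢v = cong₂ _∨_ (⌊≟V⌋-false x≢u) (⌊≟V⌋-false x≢v)

incident-prefix-other : ∀ {c d} → c ≢ d → ∀ y e → incident (d ∷ y) (prefix c e) ≡ false
incident-prefix-other c≢d y e = incident-false (c≢d ∘ sym ∘ ∷-injectiveˡ) (c≢d ∘ sym ∘ ∷-injectiveˡ)

incidentKeys-++ : ∀ es es' x → incidentKeys (es ++ es') x ≡ incidentKeys es x ++ incidentKeys es' x
incidentKeys-++ es es' x =
  trans (cong edgeKeys (filter-++ (T? ∘ incident x) es es')) (map-++ proj₁ (filterᵇ (incident x) es) _)

incidentKeys-prefix : ∀ c y es → incidentKeys (map (prefix c) es) (c ∷ y) ≡ map (c ∷_) (incidentKeys es y)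
incidentKeys-prefix c y [] = refl
incidentKeys-prefix c y (e ∷ es) rewrite incident-prefix c y e with incident y e
... | true  = cong ((c ∷ proj₁ e) ∷_) (incidentKeys-prefix c y es)
... | false = incidentKeys-prefix c y es

incidentKeys-prefix-other : ∀ {c d} → c ≢ d → ∀ y es → incidentKeys (map (prefix c) es) (d ∷ y) ≡ []
incidentKeys-prefix-other c≢d y [] = refl
incidentKeys-prefix-other c≢d y (e ∷ es) rewrite incident-prefix-other c≢d y e = incidentKeys-prefix-other c≢d y es

incidentKeys-root-prefix : ∀ c es → incidentKeys (map (prefix c) es) [] ≡ []
incidentKeys-root-prefix c [] = refl
incidentKeys-root-prefix c (e ∷ es) = incidentKeys-root-prefix c es

incidentKeys-concatMap : ∀ (f : ℕ → List Edge) cs x →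
  incidentKeys (concatMap f cs) x ≡ concatMap (λ c → incidentKeys (f c) x) cs
incidentKeys-concatMap f [] x = refl
incidentKeys-concatMap f (c ∷ cs) x =
  trans (incidentKeys-++ (f c) (concatMap f cs) x) (cong (incidentKeys (f c) x ++_) (incidentKeys-concatMap f cs x))

concatMap-vanishing-off : ∀ {A : Set} (f : ℕ → List A) {d cs} → Unique cs → d ∈ cs →
  (∀ c → c ≢ d → f c ≡ []) → concatMap f cs ≡ f d
concatMap-vanishing-off f {d} {c ∷ cs} (d∉ ∷ _) (here refl) vanish =
  trans (cong (f c ++_) (concatMap-vanish cs d∉)) (++-identityʳ (f c))
  where
  concatMap-vanish : ∀ cs → All (c ≢_) cs → concatMap f cs ≡ []
  concatMap-vanish [] [] = refl
  concatMap-vanish (c' ∷ cs) (c≢c' ∷ c∉) rewrite vanish c' (c≢c' ∘ sym) = concatMap-vanish cs c∉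
concatMap-vanishing-off f {d} {c ∷ cs} (c∉ ∷ unique) (there d∈) vanish
  rewrite vanish c (λ { refl → All.lookup c∉ d∈ refl }) = concatMap-vanishing-off f unique d∈ vanish

concatMap-map≡cartesianProductWith : ∀ {A B C : Set} (f : A → B → C) xs ys →
  concatMap (λ x → map (f x) ys) xs ≡ cartesianProductWith f xs ys
concatMap-map≡cartesianProductWith f [] ys = refl
concatMap-map≡cartesianProductWith f (x ∷ xs) ys =
  cong (map (f x) ys ++_) (concatMap-map≡cartesianProductWith f xs ys)

treeVertices-∷ : ∀ b bs → treeVertices (b ∷ bs) ≡ [] ∷ cartesianProductWith _∷_ (upTo b) (treeVertices bs)
treeVertices-∷ b bs = cong ([] ∷_) (concatMap-map≡cartesianProductWith _∷_ (upTo b) (treeVertices bs))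

∷∈treeVertices⁻ : ∀ {b bs d y} → (d ∷ y) ∈ treeVertices (b ∷ bs) → d < b × y ∈ treeVertices bs
∷∈treeVertices⁻ {b} {bs} {d} {y} (there x∈)
  with _ , _ , d∈ , y∈ , refl ← ∈-cartesianProductWith⁻ _∷_ (upTo b) (treeVertices bs)
         (subst ((d ∷ y) ∈_) (concatMap-map≡cartesianProductWith _∷_ (upTo b) (treeVertices bs)) x∈)
  = ∈-upTo⁻ d∈ , y∈

parentEdgeKey : Vertex → List Vertex
parentEdgeKey [] = []
parentEdgeKey x@(_ ∷ _) = [ x ]

children : List ℕ → Vertex → List Vertex
children bs x = childrenOf (branching bs (length x)) x

incidentKeys-tree : ∀ bs {x} → x ∈ treeVertices bs →
  incidentKeys (treeEdges bs) x ≡ parentEdgeKey x ++ children bs x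
incidentKeys-tree [] (here refl) = refl
incidentKeys-tree (b ∷ bs) {[]} _ = begin
  incidentKeys (treeEdges (b ∷ bs)) []
    ≡⟨ incidentKeys-concatMap (treeBlock bs) (upTo b) [] ⟩
  concatMap (λ c → incidentKeys (treeBlock bs c) []) (upTo b)
    ≡⟨ concatMap-cong (λ c → cong ([ c ] ∷_) (incidentKeys-root-prefix c (treeEdges bs))) (upTo b) ⟩
  concatMap (λ c → [ [ c ] ]) (upTo b)
    ≡⟨ concatMap-map [_] [_] (upTo b) ⟨
  concatMap [_] (map [_] (upTo b))
    ≡⟨ concatMap-pure (map [_] (upTo b)) ⟩
  map [_] (upTo b) ∎
  where open ≡-Reasoning
incidentKeys-tree (b ∷ bs) {d ∷ y} x∈ with d<b , y∈ ← ∷∈treeVertices⁻ x∈ = begin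
  incidentKeys (treeEdges (b ∷ bs)) (d ∷ y)
    ≡⟨ incidentKeys-concatMap (treeBlock bs) (upTo b) (d ∷ y) ⟩
  concatMap (λ c → incidentKeys (treeBlock bs c) (d ∷ y)) (upTo b)
    ≡⟨ concatMap-vanishing-off (λ c → incidentKeys (treeBlock bs c) (d ∷ y)) (Unique.upTo⁺ b) (∈-upTo⁺ d<b) otherBlock ⟩
  incidentKeys ([ top ] ++ map (prefix d) E) (d ∷ y)
    ≡⟨ incidentKeys-++ [ top ] (map (prefix d) E) (d ∷ y) ⟩
  incidentKeys [ top ] (d ∷ y) ++ incidentKeys (map (prefix d) E) (d ∷ y)
    ≡⟨ cong (incidentKeys [ top ] (d ∷ y) ++_) (incidentKeys-prefix d y E) ⟩
  incidentKeys [ top ] (d ∷ y) ++ map (d ∷_) (incidentKeys E y)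
    ≡⟨ cong (λ ks → incidentKeys [ top ] (d ∷ y) ++ map (d ∷_) ks) (incidentKeys-tree bs y∈) ⟩
  incidentKeys [ top ] (d ∷ y) ++ map (d ∷_) (parentEdgeKey y ++ children bs y)
    ≡⟨ ownKey y ⟩
  (d ∷ y) ∷ children (b ∷ bs) (d ∷ y) ∎
  where
  open ≡-Reasoning
  E = treeEdges bs
  top = ([ d ] , [])
  otherBlock : ∀ c → c ≢ d → incidentKeys (treeBlock bs c) (d ∷ y) ≡ []
  otherBlock c c≢d rewrite incident-false {d ∷ y} {[ c ]} {[]} (c≢d ∘ sym ∘ ∷-injectiveˡ) (λ ()) =
    incidentKeys-prefix-other c≢d y E
  ownKey : ∀ y → incidentKeys [ top ] (d ∷ y) ++ map (d ∷_) (parentEdgeKey y ++ children bs y)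
                 ≡ (d ∷ y) ∷ children (b ∷ bs) (d ∷ y)
  ownKey [] rewrite incident-child [ d ] [] = cong ([ d ] ∷_) (map-∷-childrenOf d [] _)
  ownKey (e ∷ y) rewrite incident-false {d ∷ e ∷ y} {[ d ]} {[]} (λ ()) (λ ()) =
    cong ((d ∷ e ∷ y) ∷_) (map-∷-childrenOf d (e ∷ y) _)

edgeKeys-prefix : ∀ c es → edgeKeys (map (prefix c) es) ≡ map (c ∷_) (edgeKeys es)
edgeKeys-prefix c es = trans (sym (map-∘ es)) (map-∘ es)

treeVertices≡[]∷edgeKeys : ∀ bs → treeVertices bs ≡ [] ∷ edgeKeys (treeEdges bs)
treeVertices≡[]∷edgeKeys [] = refl
treeVertices≡[]∷edgeKeys (b ∷ bs) = cong ([] ∷_) (begin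
  concatMap (λ c → map (c ∷_) (treeVertices bs)) (upTo b)
    ≡⟨ concatMap-cong (λ c → cong (map (c ∷_)) (treeVertices≡[]∷edgeKeys bs)) (upTo b) ⟩
  concatMap (λ c → [ c ] ∷ map (c ∷_) (edgeKeys E)) (upTo b)
    ≡⟨ concatMap-cong (λ c → cong ([ c ] ∷_) (edgeKeys-prefix c E)) (upTo b) ⟨
  concatMap (edgeKeys ∘ treeBlock bs) (upTo b)
    ≡⟨ map-concatMap proj₁ (treeBlock bs) (upTo b) ⟨
  edgeKeys (treeEdges (b ∷ bs)) ∎)
  where
  open ≡-Reasoning
  E = treeEdges bs

treeVertices-unique : ∀ bs → Unique (treeVertices bs)
treeVertices-unique [] = [] ∷ []
treeVertices-unique (b ∷ bs) = subst Unique (sym (treeVertices-∷ b bs))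
  (All.tabulate root∉ ∷ Unique.cartesianProductWith⁺ _∷_ ∷-injective (Unique.upTo⁺ b) (treeVertices-unique bs))
  where
  root∉ : ∀ {x} → x ∈ cartesianProductWith _∷_ (upTo b) (treeVertices bs) → [] ≢ x
  root∉ x∈ with _ , _ , _ , _ , refl ← ∈-cartesianProductWith⁻ _∷_ (upTo b) (treeVertices bs) x∈ = λ ()

treeKeys-unique : ∀ bs → Unique (edgeKeys (treeEdges bs))
treeKeys-unique bs = Unique.drop⁺ 1 (subst Unique (treeVertices≡[]∷edgeKeys bs) (treeVertices-unique bs))

childrenOf-weightSum-mono : ∀ ks {y x m n} → y ≺ x → m ≤ n →
  sum (map (weight ks) (childrenOf m y)) ≤ sum (map (weight ks) (childrenOf n x))
childrenOf-weightSum-mono ks {y} {x} {m} {n} y≺x m≤n =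
  sum-map-dominated-≤ (weight ks) (childrenOf m y) (childrenOf n x)
    (subst₂ _≤_ (sym (length-childrenOf m y)) (sym (length-childrenOf n x)) m≤n)
    (λ a∈ b∈ → weight-mono ks (childrenOf-≺ y≺x a∈ b∈))

module T1-antimagic {t ts} (t≥2 : 2 ≤ t) (lk : Linked _≥_ (t ∷ ts)) where

  bs : List ℕ
  bs = t ∷ pred₁ ts

  E : List Edge
  E = treeEdges bs

  V : List Vertex
  V = treeVertices bs

  ks : List Vertex
  ks = edgeKeys E

  w : Vertex → ℕ
  w = weight ks

  Σw : List Vertex → ℕ
  Σw xs = sum (map w xs)

  bs-antitone : ∀ {i j} → i ≤ j → branching bs j ≤ branching bs i
  bs-antitone = branching-antitone (∷-pred₁-linked lk)

  branching-below-root : ∀ i → branching bs (suc i) ≤ t ∸ 1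
  branching-below-root i = subst (_≤ t ∸ 1) (sym (branching-pred₁ ts i))
    (∸-monoˡ-≤ 1 (branching-antitone lk {0} {suc i} z≤n))

  keySum≡ : ∀ {x} → x ∈ V → keySum E x ≡ Σw (parentEdgeKey x ++ children bs x)
  keySum≡ x∈ = cong Σw (incidentKeys-tree bs x∈)

  incident∈keys : ∀ {x k} → x ∈ V → k ∈ parentEdgeKey x ++ children bs x → k ∈ ks
  incident∈keys {x} {k} x∈ k∈ =
    incidentKeys⊆edgeKeys E {x} (subst (k ∈_) (sym (incidentKeys-tree bs x∈)) k∈)

  children-mono : ∀ {y x} → y ≺ x → Σw (children bs y) ≤ Σw (children bs x)
  children-mono y≺x = childrenOf-weightSum-mono ks y≺x (bs-antitone (≺-length y≺x))

  root-dominates : ∀ {d y} → (d ∷ y) ∈ V → keySum E (d ∷ y) < keySum E []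
  root-dominates {d} {y} x∈ = begin-strict
    keySum E (d ∷ y)                      ≡⟨ keySum≡ x∈ ⟩
    w (d ∷ y) + Σw (children bs (d ∷ y))  <⟨ +-mono-≤-< (parent≤ y) children< ⟩
    w [ d ] + Σw rest                     ≡⟨ sum-map-↭ w root-edges ⟨
    Σw (children bs [])                   ≡⟨ keySum≡ (here refl) ⟨
    keySum E []                           ∎
    where
    open ≤-Reasoning
    rest-↭ : ∃ λ rest → children bs [] ↭ [ d ] ∷ rest
    rest-↭ = ∈⇒↭-∷ (∈-map⁺ ([] ∷ʳ_) (∈-upTo⁺ (proj₁ (∷∈treeVertices⁻ {t} {pred₁ ts} x∈))))
    rest = proj₁ rest-↭
    root-edges = proj₂ rest-↭
    length-rest : length rest ≡ t ∸ 1
    length-rest = cong (_∸ 1) (trans (sym (↭-length root-edges)) (length-childrenOf t []))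
    parent≤ : ∀ y → w (d ∷ y) ≤ w [ d ]
    parent≤ [] = ≤-refl
    parent≤ (_ ∷ _) = weight-mono ks (deeper (s≤s (s≤s z≤n)))
    below : ∀ {a b} → a ∈ children bs (d ∷ y) → b ∈ rest → length b < length a
    below a∈ b∈ with c , _ , refl ← ∈-map⁻ ([] ∷ʳ_) (∈-resp-↭ (↭-sym root-edges) (there b∈)) =
      ≤-trans (s≤s (s≤s z≤n)) (childrenOf-deeper a∈)
    children< : Σw (children bs (d ∷ y)) < Σw rest
    children< = sum-map-dominated-< w (λ _ → s≤s z≤n) (children bs (d ∷ y)) rest
      (subst₂ _≤_ (sym (length-childrenOf _ (d ∷ y))) (sym length-rest) (branching-below-root (length y)))
      (subst (0 <_) (sym length-rest) (∸-monoˡ-≤ 1 t≥2))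
      (λ a∈ b∈ → weight-strict ks (incident∈keys x∈ (there a∈)) (deeper (below a∈ b∈)))

  keySum-mono : ∀ {x y} → x ∈ V → y ∈ V → y ≺ x → keySum E y < keySum E x
  keySum-mono {_} {[]} _ _ []≺x = ⊥-elim ([]-minimal []≺x)
  keySum-mono {[]} {_ ∷ _} _ y∈ _ = root-dominates y∈
  keySum-mono {x@(_ ∷ _)} {y@(_ ∷ _)} x∈ y∈ y≺x = begin-strict
    keySum E y                ≡⟨ keySum≡ y∈ ⟩
    w y + Σw (children bs y)  <⟨ +-mono-<-≤ parent< (children-mono y≺x) ⟩
    w x + Σw (children bs x)  ≡⟨ keySum≡ x∈ ⟨
    keySum E x                ∎
    where
    open ≤-Reasoning
    parent< = weight-strict ks (incident∈keys y∈ (here refl)) y≺x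

  degree≡ : ∀ {x} → x ∈ V →
    length (incidentKeys E x) ≡ length (parentEdgeKey x) + branching bs (length x)
  degree≡ {x} x∈ = trans (cong length (incidentKeys-tree bs x∈))
    (trans (length-++ (parentEdgeKey x)) (cong (length (parentEdgeKey x) +_) (length-childrenOf _ x)))

  degree-antitone : ∀ {x y} → x ∈ V → y ∈ V → x ≺ y → length (incidentKeys E x) ≤ length (incidentKeys E y)
  degree-antitone {x} {y} x∈ y∈ x≺y = subst₂ _≤_ (sym (degree≡ x∈)) (sym (degree≡ y∈)) (antitone x y x≺y)
    where
    antitone : ∀ x y → x ≺ y →
      length (parentEdgeKey x) + branching bs (length x) ≤ length (parentEdgeKey y) + branching bs (length y)
    antitone [] _ []≺y = ⊥-elim ([]-minimal []≺y)
    antitone (_ ∷ x) [] _ =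
      ≤-trans (s≤s (branching-below-root (length x))) (≤-reflexive (m+[n∸m]≡n (≤-trans (s≤s z≤n) t≥2)))
    antitone (_ ∷ _) (_ ∷ _) x≺y = s≤s (bs-antitone (≺-length x≺y))

  stronglyAntimagic : StronglyAntimagic (T1 (t ∷ ts))
  stronglyAntimagic = stronglyAntimagic-byRank (T1 (t ∷ ts)) (treeKeys-unique bs) keySum-mono degree-antitone

-- both roots of T² are incident to the root edge, whose key is [ 0 ]
parentEdgeKey₂ : ℕ → Vertex → List Vertex
parentEdgeKey₂ r [] = [ [ 0 ] ]
parentEdgeKey₂ r a@(_ ∷ _) = [ r ∷ a ]

module T2-antimagic {t ts} (t≥2 : 2 ≤ t) (lk : Linked _≥_ (t ∷ ts)) where

  B : List ℕ
  B = pred₁ (t ∷ ts)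

  E : List Edge
  E = treeEdges B

  V : List Vertex
  V = treeVertices B

  G : Graph
  G = T2 (t ∷ ts)

  ks : List Vertex
  ks = edgeKeys (edges G)

  w : Vertex → ℕ
  w = weight ks

  Σw : List Vertex → ℕ
  Σw xs = sum (map w xs)

  B-antitone : ∀ {i j} → i ≤ j → branching B j ≤ branching B i
  B-antitone = branching-antitone (pred₁-linked lk)

  children₂ : ℕ → Vertex → List Vertex
  children₂ r a = childrenOf (branching B (length a)) (r ∷ a)

  incident₂ : ℕ → Vertex → List Vertex
  incident₂ r a = parentEdgeKey₂ r a ++ children₂ r a

  keys≡ : ks ≡ map (0 ∷_) V ++ map (1 ∷_) (edgeKeys E)
  keys≡ = begin
    [ 0 ] ∷ edgeKeys (map (prefix 0) E ++ map (prefix 1) E)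
      ≡⟨ cong ([ 0 ] ∷_) (map-++ proj₁ (map (prefix 0) E) (map (prefix 1) E)) ⟩
    [ 0 ] ∷ edgeKeys (map (prefix 0) E) ++ edgeKeys (map (prefix 1) E)
      ≡⟨ cong₂ (λ xs ys → [ 0 ] ∷ xs ++ ys) (edgeKeys-prefix 0 E) (edgeKeys-prefix 1 E) ⟩
    map (0 ∷_) ([] ∷ edgeKeys E) ++ map (1 ∷_) (edgeKeys E)
      ≡⟨ cong (λ xs → map (0 ∷_) xs ++ map (1 ∷_) (edgeKeys E)) (treeVertices≡[]∷edgeKeys B) ⟨
    map (0 ∷_) V ++ map (1 ∷_) (edgeKeys E) ∎
    where open ≡-Reasoning

  keys-unique : Unique ks
  keys-unique = subst Unique (sym keys≡)
    (Unique.++⁺ (Unique.map⁺ ∷-injectiveʳ (treeVertices-unique B)) (Unique.map⁺ ∷-injectiveʳ (treeKeys-unique B))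
      disjoint)
    where
    disjoint : ∀ {k} → ¬ (k ∈ map (0 ∷_) V × k ∈ map (1 ∷_) (edgeKeys E))
    disjoint (k∈₀ , k∈₁) with _ , _ , refl ← ∈-map⁻ (0 ∷_) k∈₀ | _ , _ , () ← ∈-map⁻ (1 ∷_) k∈₁

  vertex⁻ : ∀ {x} → x ∈ vertices G → ∃₂ λ r a → x ≡ r ∷ a × r < 2 × a ∈ V
  vertex⁻ x∈ with ∈-++⁻ (map (0 ∷_) V) x∈
  ... | inj₁ x∈₀ with a , a∈ , refl ← ∈-map⁻ (0 ∷_) x∈₀ = 0 , a , refl , s≤s z≤n , a∈
  ... | inj₂ x∈₁ with a , a∈ , refl ← ∈-map⁻ (1 ∷_) x∈₁ = 1 , a , refl , s≤s (s≤s z≤n) , a∈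

  incidentKeys-T2 : ∀ {r a} → r < 2 → a ∈ V → incidentKeys (edges G) (r ∷ a) ≡ incident₂ r a
  incidentKeys-T2 {r} {a} r<2 a∈ = begin
    incidentKeys (edges G) (r ∷ a)
      ≡⟨ incidentKeys-++ [ root ] (map (prefix 0) E ++ map (prefix 1) E) (r ∷ a) ⟩
    rootKey ++ incidentKeys (map (prefix 0) E ++ map (prefix 1) E) (r ∷ a)
      ≡⟨ cong (rootKey ++_) (incidentKeys-++ (map (prefix 0) E) (map (prefix 1) E) (r ∷ a)) ⟩
    rootKey ++ (incidentKeys (map (prefix 0) E) (r ∷ a) ++ incidentKeys (map (prefix 1) E) (r ∷ a))
      ≡⟨ cong (rootKey ++_) (subtrees r<2) ⟩
    rootKey ++ map (r ∷_) (incidentKeys E a)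
      ≡⟨ cong (λ ks → rootKey ++ map (r ∷_) ks) (incidentKeys-tree B a∈) ⟩
    rootKey ++ map (r ∷_) (parentEdgeKey a ++ children B a)
      ≡⟨ ownKey r<2 a ⟩
    incident₂ r a ∎
    where
    open ≡-Reasoning
    root = ([ 0 ] , [ 1 ])
    rootKey = incidentKeys [ root ] (r ∷ a)
    subtrees : ∀ {r} → r < 2 →
      incidentKeys (map (prefix 0) E) (r ∷ a) ++ incidentKeys (map (prefix 1) E) (r ∷ a)
      ≡ map (r ∷_) (incidentKeys E a)
    subtrees (s≤s z≤n) =
      trans (cong₂ _++_ (incidentKeys-prefix 0 a E) (incidentKeys-prefix-other (λ ()) a E)) (++-identityʳ _)
    subtrees (s≤s (s≤s z≤n)) = cong₂ _++_ (incidentKeys-prefix-other (λ ()) a E) (incidentKeys-prefix 1 a E)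
    ownKey : ∀ {r} → r < 2 → ∀ a →
      incidentKeys [ root ] (r ∷ a) ++ map (r ∷_) (parentEdgeKey a ++ children B a) ≡ incident₂ r a
    ownKey (s≤s z≤n) [] = cong ([ 0 ] ∷_) (map-∷-childrenOf 0 [] _)
    ownKey (s≤s z≤n) (e ∷ a) = cong ((0 ∷ e ∷ a) ∷_) (map-∷-childrenOf 0 (e ∷ a) _)
    ownKey (s≤s (s≤s z≤n)) [] = cong ([ 0 ] ∷_) (map-∷-childrenOf 1 [] _)
    ownKey (s≤s (s≤s z≤n)) (e ∷ a) = cong ((1 ∷ e ∷ a) ∷_) (map-∷-childrenOf 1 (e ∷ a) _)

  incident∈keys : ∀ {r a k} → r < 2 → a ∈ V → k ∈ incident₂ r a → k ∈ ks
  incident∈keys {r} {a} {k} r<2 a∈ k∈ =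
    incidentKeys⊆edgeKeys (edges G) {r ∷ a} (subst (k ∈_) (sym (incidentKeys-T2 r<2 a∈)) k∈)

  children-mono : ∀ {r a r' a'} → (r' ∷ a') ≺ (r ∷ a) → Σw (children₂ r' a') ≤ Σw (children₂ r a)
  children-mono y≺x = childrenOf-weightSum-mono ks y≺x (B-antitone (≤-pred (≺-length y≺x)))

  incident₂-mono : ∀ {r a r' a'} → r' < 2 → a' ∈ V → (r' ∷ a') ≺ (r ∷ a) → Σw (incident₂ r' a') < Σw (incident₂ r a)
  incident₂-mono {r} {[]} {r'} {[]} r'<2 a'∈ y≺x =
    +-monoʳ-< (w [ 0 ]) (sum-map-dominated-< w (λ _ → s≤s z≤n) (children₂ r' []) (children₂ r [])
      (≤-reflexive (trans (length-childrenOf (t ∸ 1) [ r' ]) (sym (length-childrenOf (t ∸ 1) [ r ]))))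
      (subst (0 <_) (sym (length-childrenOf (t ∸ 1) [ r ])) (∸-monoˡ-≤ 1 t≥2))
      (λ a∈ b∈ → weight-strict ks (incident∈keys r'<2 a'∈ (there a∈)) (childrenOf-≺ y≺x a∈ b∈)))
  incident₂-mono {r} {[]} {r'} {_ ∷ _} r'<2 a'∈ y≺x =
    +-mono-<-≤ (weight-strict ks (incident∈keys r'<2 a'∈ (here refl)) (deeper {k' = [ 0 ]} (s≤s (s≤s z≤n))))
      (children-mono y≺x)
  incident₂-mono {r} {_ ∷ _} {r'} {[]} _ _ y≺x with ≺-length y≺x
  ... | s≤s ()
  incident₂-mono {r} {_ ∷ _} {r'} {_ ∷ _} r'<2 a'∈ y≺x =
    +-mono-<-≤ (weight-strict ks (incident∈keys r'<2 a'∈ (here refl)) y≺x) (children-mono y≺x)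

  keySum-mono : ∀ {x y} → x ∈ vertices G → y ∈ vertices G → y ≺ x → keySum (edges G) y < keySum (edges G) x
  keySum-mono x∈ y∈ y≺x with _ , _ , refl , r<2 , a∈ ← vertex⁻ x∈ | _ , _ , refl , r'<2 , a'∈ ← vertex⁻ y∈ =
    subst₂ _<_ (cong Σw (sym (incidentKeys-T2 r'<2 a'∈))) (cong Σw (sym (incidentKeys-T2 r<2 a∈)))
      (incident₂-mono r'<2 a'∈ y≺x)

  length-incident₂ : ∀ r a → length (incident₂ r a) ≡ suc (branching B (length a))
  length-incident₂ r [] = cong suc (length-childrenOf _ [ r ])
  length-incident₂ r a@(_ ∷ _) = cong suc (length-childrenOf _ (r ∷ a))

  degree-antitone : ∀ {x y} → x ∈ vertices G → y ∈ vertices G → x ≺ y →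
    length (incidentKeys (edges G) x) ≤ length (incidentKeys (edges G) y)
  degree-antitone x∈ y∈ x≺y with _ , a , refl , r<2 , a∈ ← vertex⁻ x∈ | _ , a' , refl , r'<2 , a'∈ ← vertex⁻ y∈ =
    subst₂ _≤_ (cong length (sym (incidentKeys-T2 r<2 a∈))) (cong length (sym (incidentKeys-T2 r'<2 a'∈)))
      (subst₂ _≤_ (sym (length-incident₂ _ a)) (sym (length-incident₂ _ a'))
        (s≤s (B-antitone (≤-pred (≺-length x≺y)))))

  stronglyAntimagic : StronglyAntimagic G
  stronglyAntimagic = stronglyAntimagic-byRank G keys-unique keySum-mono degree-antitone

-- of the bounds tᵢ ≥ 2 only t₀ ≥ 2 is needed
corollary2p4 : (ts : List ℕ) → 1 ≤ length ts → All (2 ≤_) ts → Linked _≥_ ts →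
    StronglyAntimagic (T1 ts) × StronglyAntimagic (T2 ts)
corollary2p4 (t ∷ ts) _ (t≥2 ∷ _) lk =
  T1-antimagic.stronglyAntimagic t≥2 lk , T2-antimagic.stronglyAntimagic t≥2 lk
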